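{- Let $n$ be a positive integer and $\lambda$ a positive integer. If the graph $P_n$ (the $4\times n$ grid with a sticky end on both sides) admits a $\lambda$-ranking, then $r(4,2n+4)\le \lambda+4$.
   Context: A $k$-ranking of a graph $G$ is a labeling $f:V(G)\to\{1,\dots,k\}$ such that every path between two distinct vertices with the same label contains a vertex with a larger label; $\chi_r(G)$ is the least such $k$. $G_{m,n}$ is the $m\times n$ grid graph and $r(m,n)=\chi_r(G_{m,n})$. All graphs below are induced subgraphs of the infinite grid on $\mathbb{Z}^2$ (vertices $(i,j)$, adjacent iff they agree in one coordinate and differ by $1$ in the other), with $i$ the row index. The $4\times n$ grid with a sticky end on both sides is $P_n$, the induced subgraph on $\{(i,j): 1\le i\le 4,\ i-3\le j\le n+i-1\}$; i.e. the $4\times n$ grid on columns $1,\dots,n$ with a staircase of $3,2,1,0$ extra vertices appended to the left of rows $1,2,3,4$ and a staircase of $0,1,2,3$ extra vertices appended to the right of rows $1,2,3,4$. -}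

module Defs where

open import Data.Nat as ℕ using (ℕ)
open import Data.Integer as ℤ using (ℤ; +_; _-_; ∣_∣)
open import Data.Product using (_×_; _,_; Σ; ∃)
open import Data.Sum using (_⊎_)
open import Data.List using (List; []; _∷_)
open import Data.List.Relation.Unary.Any using (Any)
open import Data.List.Relation.Unary.Unique.Propositional using (Unique)
open import Relation.Binary.PropositionalEquality using (_≡_)
open import Relation.Nullary using (¬_)

-- Points of the infinite grid ℤ², (i , j) with i the row index.
Pt : Set
Pt = ℤ × ℤ

Adj : Pt → Pt → Set
Adj (i , j) (i' , j') = (i ≡ i' × ∣ j - j' ∣ ≡ 1) ⊎ (j ≡ j' × ∣ i - i' ∣ ≡ 1)

-- A graph here is an induced subgraph of the infinite grid, given by its vertex set.
VSet : Set₁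
VSet = Pt → Set

data Walk (V : VSet) : Pt → Pt → List Pt → Set where
  single : ∀ {u} → V u → Walk V u u (u ∷ [])
  step   : ∀ {u v w xs} → V u → Adj u v → Walk V v w xs → Walk V u w (u ∷ xs)

Path : VSet → Pt → Pt → List Pt → Set
Path V u w xs = Walk V u w xs × Unique xs

-- f is a k-ranking of the induced subgraph with vertex set V
-- (f is given on all of ℤ², only its values on V matter).
IsRanking : ℕ → VSet → (Pt → ℕ) → Set
IsRanking k V f =
  (∀ v → V v → 1 ℕ.≤ f v × f v ℕ.≤ k) ×
  (∀ u w xs → Path V u w xs → ¬ (u ≡ w) → f u ≡ f w →
     Any (λ x → f u ℕ.< f x) xs)

HasRanking : ℕ → VSet → Set
HasRanking k V = ∃ λ f → IsRanking k V f

Grid : ℕ → ℕ → VSet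
Grid m n (i , j) = (+ 1 ℤ.≤ i × i ℤ.≤ + m) × (+ 1 ℤ.≤ j × j ℤ.≤ + n)

StickyP : ℕ → VSet
StickyP n (i , j) = (+ 1 ℤ.≤ i × i ℤ.≤ + 4) × (i - + 3 ℤ.≤ j × j ℤ.≤ (+ n ℤ.+ i) - + 1)

-- Cut the 4 × (2n+4) grid along the diagonal j = i + n. The part strictly below it is a copy
-- of P_n, the part strictly above it is a copy of P_n turned by a half turn, and the diagonal
-- itself has exactly one vertex in each row. Rank both halves with the given λ-ranking and give
-- the diagonal vertex in row i the label λ + i. The level j - i - n changes by ±1 along every
-- edge, so a path leaving a half meets the diagonal, where the label exceeds every label of the
-- halves; two diagonal vertices never share a label.
module Submission where

open import Defs
open import Data.Nat using (ℕ; zero; suc; _+_; _*_; _≤_; _<_; z≤n; s≤s)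
import Data.Nat.Properties as ℕₚ
open import Data.Integer as ℤ using (ℤ; +_; -[1+_]; +[1+_]; ∣_∣; +≤+)
import Data.Integer.Properties as ℤₚ
open import Data.Integer.Tactic.RingSolver using (solve-∀)
open import Data.Product using (_×_; _,_; proj₁; proj₂)
open import Data.Sum using (_⊎_; inj₁; inj₂; [_,_])
open import Data.Empty using (⊥-elim)
open import Data.List using (map)
open import Data.List.Relation.Unary.Any using (Any; here; there)
import Data.List.Relation.Unary.Any as Any
import Data.List.Relation.Unary.Any.Properties as Anyₚ
import Data.List.Relation.Unary.Unique.Propositional.Properties as Uniqueₚ
open import Function using (_∘_; id)
open import Relation.Binary.PropositionalEquality
  using (_≡_; _≢_; refl; sym; trans; cong; cong₂; subst; subst₂)
open import Relation.Nullary using (¬_)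

walk-start : ∀ {V u w xs} → Walk V u w xs → V u
walk-start (single vu) = vu
walk-start (step vu _ _) = vu

walk-end : ∀ {V u w xs} → Walk V u w xs → V w
walk-end (single vw) = vw
walk-end (step _ _ rest) = walk-end rest

walk-head : ∀ {V} {P : Pt → Set} {u w xs} → Walk V u w xs → P u → Any P xs
walk-head (single _) p = here p
walk-head (step _ _ _) p = here p

walk-any-inside : ∀ {V} {P : Pt → Set} {u w xs} →
                  Walk V u w xs → Any P xs → Any (λ x → V x × P x) xs
walk-any-inside (single vu) (here p) = here (vu , p)
walk-any-inside (step vu _ _) (here p) = here (vu , p)
walk-any-inside (step _ _ rest) (there p) = there (walk-any-inside rest p)

walk-map : ∀ {V W : VSet} (φ : Pt → Pt) → (∀ {v} → V v → W (φ v)) →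
           (∀ {u v} → Adj u v → Adj (φ u) (φ v)) →
           ∀ {u w xs} → Walk V u w xs → Walk W (φ u) (φ w) (map φ xs)
walk-map φ V→W adj (single vu) = single (V→W vu)
walk-map φ V→W adj (step vu a rest) = step (V→W vu) (adj a) (walk-map φ V→W adj rest)

IsRanking-cong : ∀ {k V f f′} → (∀ {v} → V v → f v ≡ f′ v) → IsRanking k V f → IsRanking k V f′
IsRanking-cong {k} {V} {f} {f′} f≗f′ (bounded , ranked) = bounded′ , ranked′
  where
  bounded′ : ∀ v → V v → 1 ≤ f′ v × f′ v ≤ k
  bounded′ v vv rewrite sym (f≗f′ vv) = bounded v vv

  ranked′ : ∀ u w xs → Path V u w xs → ¬ u ≡ w → f′ u ≡ f′ w → Any (λ x → f′ u < f′ x) xs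
  ranked′ u w xs path@(walk , _) u≢w f′u≡f′w =
    Any.map higher (walk-any-inside walk (ranked u w xs path u≢w fu≡fw))
    where
    fu≡fw : f u ≡ f w
    fu≡fw = trans (f≗f′ (walk-start walk)) (trans f′u≡f′w (sym (f≗f′ (walk-end walk))))

    higher : ∀ {x} → V x × f u < f x → f′ u < f′ x
    higher (vx , fu<fx) = subst₂ _<_ (f≗f′ (walk-start walk)) (f≗f′ vx) fu<fx

IsRanking-pullback : ∀ {k V W f} (φ : Pt → Pt) → (∀ {v} → V v → W (φ v)) →
                     (∀ {u v} → Adj u v → Adj (φ u) (φ v)) → (∀ {u v} → φ u ≡ φ v → u ≡ v) →
                     IsRanking k W f → IsRanking k V (f ∘ φ)
IsRanking-pullback φ V→W adj φ-injective (bounded , ranked) =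
  (λ v vv → bounded (φ v) (V→W vv)) ,
  λ u w xs (walk , unique) u≢w same-label →
    Anyₚ.map⁻ (ranked (φ u) (φ w) (map φ xs)
                 (walk-map φ V→W adj walk , Uniqueₚ.map⁺ φ-injective unique)
                 (u≢w ∘ φ-injective) same-label)

data Side : Set where
  below on above : Side

side : ℤ → Side
side -[1+ _ ] = below
side (+ zero) = on
side +[1+ _ ] = above

on-or-off : ∀ s → s ≡ on ⊎ s ≢ on
on-or-off below = inj₂ λ ()
on-or-off on = inj₁ refl
on-or-off above = inj₂ λ ()

side-below⇒≤-1 : ∀ {x} → side x ≡ below → x ℤ.≤ -[1+ 0 ]
side-below⇒≤-1 { -[1+ _ ]} refl = ℤ.-≤- z≤n
side-below⇒≤-1 { + zero} ()
side-below⇒≤-1 { +[1+ _ ]} ()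

side-above⇒≥1 : ∀ {x} → side x ≡ above → + 1 ℤ.≤ x
side-above⇒≥1 { +[1+ _ ]} refl = +≤+ (s≤s z≤n)
side-above⇒≥1 { + zero} ()
side-above⇒≥1 { -[1+ _ ]} ()

side-on⇒≡0 : ∀ {x} → side x ≡ on → x ≡ + 0
side-on⇒≡0 { + zero} refl = refl
side-on⇒≡0 { +[1+ _ ]} ()
side-on⇒≡0 { -[1+ _ ]} ()

UnitStep : ℤ → ℤ → Set
UnitStep x y = y ≡ x ℤ.+ + 1 ⊎ y ≡ x ℤ.- + 1

side-continuous : ∀ x {y} → UnitStep x y → side x ≡ on ⊎ side y ≡ on ⊎ side y ≡ side x
side-continuous (+ zero) _ = inj₁ refl
side-continuous +[1+ _ ] (inj₁ refl) = inj₂ (inj₂ refl)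
side-continuous +[1+ zero ] (inj₂ refl) = inj₂ (inj₁ refl)
side-continuous +[1+ suc _ ] (inj₂ refl) = inj₂ (inj₂ refl)
side-continuous -[1+ zero ] (inj₁ refl) = inj₂ (inj₁ refl)
side-continuous -[1+ suc _ ] (inj₁ refl) = inj₂ (inj₂ refl)
side-continuous -[1+ _ ] (inj₂ refl) = inj₂ (inj₂ refl)

Region : VSet → (Pt → ℤ) → Side → VSet
Region G D s v = G v × side (D v) ≡ s

stay-or-cross : ∀ {G D} → (∀ {u v} → Adj u v → UnitStep (D u) (D v)) →
                ∀ {u w xs} → Walk G u w xs →
                Any (Region G D on) xs ⊎ Walk (Region G D (side (D u))) u w xs
stay-or-cross D-unit (single gu) = inj₂ (single (gu , refl))
stay-or-cross {G} {D} D-unit (step {u} gu a rest) with side-continuous (D u) (D-unit a)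
... | inj₁ u-on = inj₁ (here (gu , u-on))
... | inj₂ (inj₁ v-on) = inj₁ (there (walk-head rest (walk-start rest , v-on)))
... | inj₂ (inj₂ same-side) with stay-or-cross D-unit rest
...   | inj₁ crossing = inj₁ (there crossing)
...   | inj₂ stays =
        inj₂ (step (gu , refl) a (subst (λ s → Walk (Region G D s) _ _ _) same-side stays))

bySide : {A : Set} → A → A → A → Side → A
bySide a _ _ below = a
bySide _ b _ on = b
bySide _ _ c above = c

glue : (Pt → ℤ) → (Pt → ℕ) → (Pt → ℕ) → (Pt → ℕ) → Pt → ℕ
glue D fL fS fR v = bySide (fL v) (fS v) (fR v) (side (D v))

module _ {G : VSet} {D : Pt → ℤ} {k m : ℕ} {fL fS fR : Pt → ℕ}
         (D-unit : ∀ {u v} → Adj u v → UnitStep (D u) (D v))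
         (fL-rank : IsRanking k (Region G D below) fL)
         (fR-rank : IsRanking k (Region G D above) fR)
         (fS-range : ∀ {v} → Region G D on v → k < fS v × fS v ≤ k + m)
         (fS-injective : ∀ {u v} → Region G D on u → Region G D on v → fS u ≡ fS v → u ≡ v)
         where

  private
    g : Pt → ℕ
    g = glue D fL fS fR

    glue-at : ∀ {v s} → side (D v) ≡ s → g v ≡ bySide (fL v) (fS v) (fR v) s
    glue-at {v} = cong (bySide (fL v) (fS v) (fR v))

    off-rank : ∀ s → s ≢ on → IsRanking k (Region G D s) g
    off-rank below _ = IsRanking-cong (sym ∘ glue-at ∘ proj₂) fL-rank
    off-rank on s≢on = ⊥-elim (s≢on refl)
    off-rank above _ = IsRanking-cong (sym ∘ glue-at ∘ proj₂) fR-rank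

    off-small : ∀ {v} → G v → side (D v) ≢ on → g v ≤ k
    off-small {v} gv off = proj₂ (proj₁ (off-rank _ off) v (gv , refl))

    on-large : ∀ {v} → Region G D on v → k < g v
    on-large r@(_ , v-on) = subst (k <_) (sym (glue-at v-on)) (proj₁ (fS-range r))

    on-unique-label : ∀ {u w} → Region G D on u → G w → ¬ u ≡ w → g u ≢ g w
    on-unique-label {w = w} u-on gw u≢w gu≡gw with on-or-off (side (D w))
    ... | inj₁ w-on =
          u≢w (fS-injective u-on (gw , w-on)
                 (trans (sym (glue-at (proj₂ u-on))) (trans gu≡gw (glue-at w-on))))
    ... | inj₂ w-off = ℕₚ.<⇒≱ (on-large u-on) (subst (_≤ k) (sym gu≡gw) (off-small gw w-off))

    off-ranked : ∀ {u w xs} → side (D u) ≢ on → Path G u w xs → ¬ u ≡ w → g u ≡ g w →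
                 Any (λ x → g u < g x) xs
    off-ranked u-off (walk , unique) u≢w gu≡gw with stay-or-cross D-unit walk
    ... | inj₁ crossing =
          Any.map (ℕₚ.≤-<-trans (off-small (walk-start walk) u-off) ∘ on-large) crossing
    ... | inj₂ stays = proj₂ (off-rank _ u-off) _ _ _ (stays , unique) u≢w gu≡gw

  glue-isRanking : IsRanking (k + m) G (glue D fL fS fR)
  glue-isRanking = bounded , ranked
    where
    bounded : ∀ v → G v → 1 ≤ g v × g v ≤ k + m
    bounded v gv with on-or-off (side (D v))
    ... | inj₁ v-on =
          ℕₚ.≤-trans (s≤s z≤n) (on-large (gv , v-on)) ,
          subst (_≤ k + m) (sym (glue-at v-on)) (proj₂ (fS-range (gv , v-on)))
    ... | inj₂ v-off =
          let (1≤gv , gv≤k) = proj₁ (off-rank _ v-off) v (gv , refl)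
          in 1≤gv , ℕₚ.m≤n⇒m≤n+o m gv≤k

    ranked : ∀ u w xs → Path G u w xs → ¬ u ≡ w → g u ≡ g w → Any (λ x → g u < g x) xs
    ranked u w xs path@(walk , _) u≢w gu≡gw with on-or-off (side (D u))
    ... | inj₁ u-on = ⊥-elim (on-unique-label (walk-start walk , u-on) (walk-end walk) u≢w gu≡gw)
    ... | inj₂ u-off = off-ranked u-off path u≢w gu≡gw

≤-by-difference : ∀ {a b} e → b ℤ.- a ≡ e → + 0 ℤ.≤ e → a ℤ.≤ b
≤-by-difference e b-a≡e 0≤e = ℤₚ.0≤i-j⇒j≤i (subst (+ 0 ℤ.≤_) (sym b-a≡e) 0≤e)

∣x∣≡1⇒x≡±1 : ∀ x → ∣ x ∣ ≡ 1 → x ≡ + 1 ⊎ x ≡ -[1+ 0 ]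
∣x∣≡1⇒x≡±1 +[1+ zero ] _ = inj₁ refl
∣x∣≡1⇒x≡±1 -[1+ zero ] _ = inj₂ refl

∣[c-x]-[c-y]∣≡∣x-y∣ : ∀ c x y → ∣ (c ℤ.- x) ℤ.- (c ℤ.- y) ∣ ≡ ∣ x ℤ.- y ∣
∣[c-x]-[c-y]∣≡∣x-y∣ c x y = trans (cong ∣_∣ (reflected c x y)) (ℤₚ.∣-i∣≡∣i∣ (x ℤ.- y))
  where
  reflected : ∀ c x y → (c ℤ.- x) ℤ.- (c ℤ.- y) ≡ ℤ.- (x ℤ.- y)
  reflected = solve-∀

c-x-injective : ∀ c {x y} → c ℤ.- x ≡ c ℤ.- y → x ≡ y
c-x-injective c {x} {y} e = trans (sym (c-[c-x]≡x c x)) (trans (cong (λ z → c ℤ.- z) e) (c-[c-x]≡x c y))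
  where
  c-[c-x]≡x : ∀ c x → c ℤ.- (c ℤ.- x) ≡ x
  c-[c-x]≡x = solve-∀

row-bounds : ∀ {i} → + 1 ℤ.≤ i → i ℤ.≤ + 4 → 1 ≤ ∣ i ∣ × ∣ i ∣ ≤ 4
row-bounds (+≤+ 1≤i) (+≤+ i≤4) = 1≤i , i≤4

rowLabel : ℕ → Pt → ℕ
rowLabel k (i , _) = k + ∣ i ∣

rowLabel-range : ∀ {k c v} → Grid 4 c v → k < rowLabel k v × rowLabel k v ≤ k + 4
rowLabel-range {k} ((1≤i , i≤4) , _) =
  let (1≤∣i∣ , ∣i∣≤4) = row-bounds 1≤i i≤4
  in ℕₚ.m<m+n k 1≤∣i∣ , ℕₚ.+-monoʳ-≤ k ∣i∣≤4

module _ (n : ℕ) where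

  diagonal : Pt → ℤ
  diagonal (i , j) = j ℤ.- (i ℤ.+ + n)

  halfTurn : Pt → Pt
  halfTurn (i , j) = (+ 5 ℤ.- i , (+ (2 * n + 4) ℤ.+ + 1) ℤ.- j)

  private
    GridN : VSet
    GridN = Grid 4 (2 * n + 4)

    +[2n+4]≡n+n+4 : + (2 * n + 4) ≡ + n ℤ.+ + n ℤ.+ + 4
    +[2n+4]≡n+n+4 =
      trans (ℤₚ.pos-+ (2 * n) 4)
            (cong (ℤ._+ + 4) (trans (ℤₚ.pos-+ n (n + 0)) (cong (λ z → + n ℤ.+ + z) (ℕₚ.+-identityʳ n))))

  diagonal-unit : ∀ {u v} → Adj u v → UnitStep (diagonal u) (diagonal v)
  diagonal-unit {i , j} {.i , j′} (inj₁ (refl , ∣j-j′∣≡1)) =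
    [ (λ e → inj₂ (shift e)) , (λ e → inj₁ (shift e)) ] (∣x∣≡1⇒x≡±1 (j ℤ.- j′) ∣j-j′∣≡1)
    where
    moved : ∀ j j′ c → j′ ℤ.- c ≡ (j ℤ.- c) ℤ.- (j ℤ.- j′)
    moved = solve-∀

    shift : ∀ {d} → j ℤ.- j′ ≡ d → diagonal (i , j′) ≡ diagonal (i , j) ℤ.- d
    shift e = trans (moved j j′ (i ℤ.+ + n)) (cong (λ d → diagonal (i , j) ℤ.- d) e)
  diagonal-unit {i , j} {i′ , .j} (inj₂ (refl , ∣i-i′∣≡1)) =
    [ (λ e → inj₁ (shift e)) , (λ e → inj₂ (shift e)) ] (∣x∣≡1⇒x≡±1 (i ℤ.- i′) ∣i-i′∣≡1)
    where
    moved : ∀ i i′ j c → j ℤ.- (i′ ℤ.+ c) ≡ (j ℤ.- (i ℤ.+ c)) ℤ.+ (i ℤ.- i′)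
    moved = solve-∀

    shift : ∀ {d} → i ℤ.- i′ ≡ d → diagonal (i′ , j) ≡ diagonal (i , j) ℤ.+ d
    shift e = trans (moved i i′ j (+ n)) (cong (λ d → diagonal (i , j) ℤ.+ d) e)

  below-diagonal⊆StickyP : ∀ {v} → Region GridN diagonal below v → StickyP n v
  below-diagonal⊆StickyP {i , j} (((1≤i , i≤4) , (1≤j , _)) , is-below) =
    (1≤i , i≤4) ,
    ≤-by-difference _ (left i j) (ℤₚ.+-mono-≤ (ℤₚ.i≤j⇒0≤j-i 1≤j) (ℤₚ.i≤j⇒0≤j-i i≤4)) ,
    ≤-by-difference _ (right i j (+ n)) (ℤₚ.i≤j⇒0≤j-i (side-below⇒≤-1 is-below))
    where
    left : ∀ i j → j ℤ.- (i ℤ.- + 3) ≡ (j ℤ.- + 1) ℤ.+ (+ 4 ℤ.- i)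
    left = solve-∀

    right : ∀ i j m → ((m ℤ.+ i) ℤ.- + 1) ℤ.- j ≡ -[1+ 0 ] ℤ.- (j ℤ.- (i ℤ.+ m))
    right = solve-∀

  above-diagonal⇒StickyP-halfTurn : ∀ {v} → Region GridN diagonal above v → StickyP n (halfTurn v)
  above-diagonal⇒StickyP-halfTurn {i , j} (((1≤i , i≤4) , (_ , j≤2n+4)) , is-above) =
    (≤-by-difference _ (top i) (ℤₚ.i≤j⇒0≤j-i i≤4) ,
     ≤-by-difference _ (bottom i) (ℤₚ.i≤j⇒0≤j-i 1≤i)) ,
    ≤-by-difference _ (left i j (+ (2 * n + 4)))
      (ℤₚ.+-mono-≤ (ℤₚ.i≤j⇒0≤j-i j≤2n+4) (ℤₚ.i≤j⇒0≤j-i 1≤i)) ,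
    ≤-by-difference _ right (ℤₚ.i≤j⇒0≤j-i (side-above⇒≥1 is-above))
    where
    top : ∀ i → (+ 5 ℤ.- i) ℤ.- + 1 ≡ + 4 ℤ.- i
    top = solve-∀

    bottom : ∀ i → + 4 ℤ.- (+ 5 ℤ.- i) ≡ i ℤ.- + 1
    bottom = solve-∀

    left : ∀ i j c → ((c ℤ.+ + 1) ℤ.- j) ℤ.- ((+ 5 ℤ.- i) ℤ.- + 3) ≡ (c ℤ.- j) ℤ.+ (i ℤ.- + 1)
    left = solve-∀

    right′ : ∀ i j m → ((m ℤ.+ (+ 5 ℤ.- i)) ℤ.- + 1) ℤ.- (((m ℤ.+ m) ℤ.+ + 4) ℤ.+ + 1 ℤ.- j)
                       ≡ (j ℤ.- (i ℤ.+ m)) ℤ.- + 1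
    right′ = solve-∀

    right : ((+ n ℤ.+ (+ 5 ℤ.- i)) ℤ.- + 1) ℤ.- ((+ (2 * n + 4) ℤ.+ + 1) ℤ.- j)
            ≡ diagonal (i , j) ℤ.- + 1
    right = trans (cong (λ c → ((+ n ℤ.+ (+ 5 ℤ.- i)) ℤ.- + 1) ℤ.- ((c ℤ.+ + 1) ℤ.- j)) +[2n+4]≡n+n+4)
                  (right′ i j (+ n))

  halfTurn-adj : ∀ {u v} → Adj u v → Adj (halfTurn u) (halfTurn v)
  halfTurn-adj {i , j} {.i , j′} (inj₁ (refl , ∣j-j′∣≡1)) =
    inj₁ (refl , trans (∣[c-x]-[c-y]∣≡∣x-y∣ (+ (2 * n + 4) ℤ.+ + 1) j j′) ∣j-j′∣≡1)
  halfTurn-adj {i , j} {i′ , .j} (inj₂ (refl , ∣i-i′∣≡1)) =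
    inj₂ (refl , trans (∣[c-x]-[c-y]∣≡∣x-y∣ (+ 5) i i′) ∣i-i′∣≡1)

  halfTurn-injective : ∀ {u v} → halfTurn u ≡ halfTurn v → u ≡ v
  halfTurn-injective e =
    cong₂ _,_ (c-x-injective (+ 5) (cong proj₁ e)) (c-x-injective (+ (2 * n + 4) ℤ.+ + 1) (cong proj₂ e))

  rowLabel-injective-on-diagonal : ∀ {k u v} →
    Region GridN diagonal on u → Region GridN diagonal on v → rowLabel k u ≡ rowLabel k v → u ≡ v
  rowLabel-injective-on-diagonal {k} {i , j} {i′ , j′}
    (((1≤i , _) , _) , u-on) (((1≤i′ , _) , _) , v-on) same-label =
    cong₂ _,_ i≡i′ j≡j′
    where
    i≡i′ : i ≡ i′
    i≡i′ = trans (sym (ℤₚ.0≤i⇒+∣i∣≡i (ℤₚ.≤-trans (+≤+ z≤n) 1≤i)))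
             (trans (cong +_ (ℕₚ.+-cancelˡ-≡ k _ _ same-label))
                    (ℤₚ.0≤i⇒+∣i∣≡i (ℤₚ.≤-trans (+≤+ z≤n) 1≤i′)))

    j-a+a≡j : ∀ j a → (j ℤ.- a) ℤ.+ a ≡ j
    j-a+a≡j = solve-∀

    j≡j′ : j ≡ j′
    j≡j′ = trans (sym (j-a+a≡j j (i ℤ.+ + n)))
             (trans (cong₂ (λ d r → d ℤ.+ (r ℤ.+ + n)) (trans (side-on⇒≡0 u-on) (sym (side-on⇒≡0 v-on))) i≡i′)
                    (j-a+a≡j j′ (i′ ℤ.+ + n)))

lemma5 : (n lam : ℕ) → 1 ≤ n → 1 ≤ lam →
    HasRanking lam (StickyP n) → HasRanking (lam + 4) (Grid 4 (2 * n + 4))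
lemma5 n lam _ _ (f , f-rank) =
  glue (diagonal n) f (rowLabel lam) (f ∘ halfTurn n) ,
  glue-isRanking (diagonal-unit n)
    (IsRanking-pullback id (below-diagonal⊆StickyP n) id id f-rank)
    (IsRanking-pullback (halfTurn n) (above-diagonal⇒StickyP-halfTurn n)
                        (halfTurn-adj n) (halfTurn-injective n) f-rank)
    (rowLabel-range ∘ proj₁)
    (rowLabel-injective-on-diagonal n)
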